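{- A Lloyd–Topor program $\Pi$ is tight if and only if there exists a natural number $n$ such that $\Pi$ has no chains of length $n$.
   Context: Formulas are first-order formulas (with equality) built from atomic formulas and $\bot$ using $\land,\lor,\rightarrow,\forall,\exists$; $\neg F$ abbreviates $F\rightarrow\bot$. A Lloyd–Topor program is a finite set of rules $p(\mathbf t)\leftarrow G$, where $p$ is a predicate constant other than equality, $\mathbf t$ a tuple of terms and $G$ a formula (the body). An occurrence of an expression in a formula is negated if it belongs to a subformula of the form $F\rightarrow\bot$, nonnegated otherwise; it is positive if the number of implications containing it in their antecedent is even. The predicate dependency graph of $\Pi$ has as vertices the predicate constants occurring in $\Pi$, and an edge from $p$ to $q$ whenever $\Pi$ has a rule with $p$ in the head whose body has a positive nonnegated occurrence of $q$; $\Pi$ is tight if this graph is acyclic. The rule dependency graph of $\Pi$ has as vertices the rules of $\Pi$ with variables (free and bound) renamed arbitrarily, and an edge from $p(\mathbf t)\leftarrow G$ to $p'(\mathbf t')\leftarrow G'$, labeled $p'(\mathbf s)$, whenever the atomic formula $p'(\mathbf s)$ has a positive nonnegated occurrence in $G$. A chain in $\Pi$ is a finite path in the rule dependency graph whose rules pairwise have no common variables (neither free nor bound); its length is its number of edges. -}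

module Defs where

open import Data.Nat using (ℕ)
open import Data.List using (List; []; _∷_; _++_)
open import Data.List.Membership.Propositional using (_∈_)
open import Data.Vec using (Vec; lookup)
open import Data.Fin using (Fin; inject₁; suc)
open import Data.Product using (Σ; ∃; ∃-syntax; _×_)
open import Relation.Binary.PropositionalEquality using (_≡_; _≢_)
open import Relation.Nullary using (¬_)
open import Function.Definitions using (Injective)
open import Relation.Binary.Construct.Closure.Transitive using (TransClosure)

-- Equality is a separate kind of atom, so
-- predicate constants (ℕ) are automatically "other than equality".
Var : Set
Var = ℕ

Pred : Set
Pred = ℕ

data Term : Set where
  var : Var → Term
  fun : ℕ → List Term → Term

data Formula : Set where
  atom : Pred → List Term → Formula
  _≐_  : Term → Term → Formula
  ⊥̇    : Formula
  _∧̇_  : Formula → Formula → Formula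
  _∨̇_  : Formula → Formula → Formula
  _⇒̇_  : Formula → Formula → Formula
  ∀̇    : Var → Formula → Formula
  ∃̇    : Var → Formula → Formula

record Atom : Set where
  constructor mkAtom
  field
    pred : Pred
    args : List Term

-- Polarity: true = positive (even number of enclosing antecedents).
data Flip : Set where
  pos neg : Flip

flip : Flip → Flip
flip pos = neg
flip neg = pos

-- An occurrence is nonnegated iff it does not lie
-- inside a subformula of the form G ⇒̇ ⊥̇; hence the antecedent of an
-- implication is only entered if its consequent is not ⊥̇ (the
-- consequent ⊥̇ contains no atoms).
data NNOcc : Flip → Atom → Formula → Set where
  here  : ∀ {p ts} → NNOcc pos (mkAtom p ts) (atom p ts)
  ∧l    : ∀ {s a F G} → NNOcc s a F → NNOcc s a (F ∧̇ G)
  ∧r    : ∀ {s a F G} → NNOcc s a G → NNOcc s a (F ∧̇ G)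
  ∨l    : ∀ {s a F G} → NNOcc s a F → NNOcc s a (F ∨̇ G)
  ∨r    : ∀ {s a F G} → NNOcc s a G → NNOcc s a (F ∨̇ G)
  ⇒ant  : ∀ {s a F G} → G ≢ ⊥̇ → NNOcc s a F → NNOcc (flip s) a (F ⇒̇ G)
  ⇒con  : ∀ {s a F G} → NNOcc s a G → NNOcc s a (F ⇒̇ G)
  ∀in   : ∀ {s a x F} → NNOcc s a F → NNOcc s a (∀̇ x F)
  ∃in   : ∀ {s a x F} → NNOcc s a F → NNOcc s a (∃̇ x F)

PosNN : Atom → Formula → Set
PosNN a F = NNOcc pos a F

record Rule : Set where
  constructor _←_
  field
    head : Atom
    body : Formula
open Rule public

Program : Set
Program = List Rule

PredEdge : Program → Pred → Pred → Set
PredEdge Π p q =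
  Σ Rule λ r → r ∈ Π × Atom.pred (head r) ≡ p × ∃[ ts ] PosNN (mkAtom q ts) (body r)

Tight : Program → Set
Tight Π = ∀ p → ¬ TransClosure (PredEdge Π) p p

mutual
  renT : (Var → Var) → Term → Term
  renT ρ (var x) = var (ρ x)
  renT ρ (fun f ts) = fun f (renTs ρ ts)

  renTs : (Var → Var) → List Term → List Term
  renTs ρ [] = []
  renTs ρ (t ∷ ts) = renT ρ t ∷ renTs ρ ts

renF : (Var → Var) → Formula → Formula
renF ρ (atom p ts) = atom p (renTs ρ ts)
renF ρ (s ≐ t) = renT ρ s ≐ renT ρ t
renF ρ ⊥̇ = ⊥̇
renF ρ (F ∧̇ G) = renF ρ F ∧̇ renF ρ G
renF ρ (F ∨̇ G) = renF ρ F ∨̇ renF ρ G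
renF ρ (F ⇒̇ G) = renF ρ F ⇒̇ renF ρ G
renF ρ (∀̇ x F) = ∀̇ (ρ x) (renF ρ F)
renF ρ (∃̇ x F) = ∃̇ (ρ x) (renF ρ F)

renR : (Var → Var) → Rule → Rule
renR ρ (mkAtom p ts ← G) = mkAtom p (renTs ρ ts) ← renF ρ G

mutual
  varsT : Term → List Var
  varsT (var x) = x ∷ []
  varsT (fun f ts) = varsTs ts

  varsTs : List Term → List Var
  varsTs [] = []
  varsTs (t ∷ ts) = varsT t ++ varsTs ts

varsF : Formula → List Var
varsF (atom p ts) = varsTs ts
varsF (s ≐ t) = varsT s ++ varsT t
varsF ⊥̇ = []
varsF (F ∧̇ G) = varsF F ++ varsF G
varsF (F ∨̇ G) = varsF F ++ varsF G
varsF (F ⇒̇ G) = varsF F ++ varsF G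
varsF (∀̇ x F) = x ∷ varsF F
varsF (∃̇ x F) = x ∷ varsF F

varsR : Rule → List Var
varsR r = varsTs (Atom.args (head r)) ++ varsF (body r)

-- Rule dependency graph: vertices are rules of Π with variables renamed
-- (injectively, so the result is a variant of the rule).
IsVertex : Program → Rule → Set
IsVertex Π r' = Σ Rule λ r → r ∈ Π × Σ (Var → Var) λ ρ → Injective _≡_ _≡_ ρ × r' ≡ renR ρ r

RuleEdge : Rule → Rule → Set
RuleEdge r r' = ∃[ s ] PosNN (mkAtom (Atom.pred (head r')) s) (body r)

record Chain (Π : Program) (n : ℕ) : Set where
  field
    rules    : Vec Rule (Data.Nat.suc n)
    vertices : ∀ i → IsVertex Π (lookup rules i)
    edges    : ∀ (i : Fin n) → RuleEdge (lookup rules (inject₁ i)) (lookup rules (suc i))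
    disjoint : ∀ i j → i ≢ j → ∀ x → x ∈ varsR (lookup rules i) → ¬ (x ∈ varsR (lookup rules j))

-- In a tight program a path in the rule dependency graph cannot pass twice
-- through variants of the same rule of Π: the head predicates along the path
-- form a walk in the predicate dependency graph, so a repetition would close a
-- cycle.  Hence there is no chain of length |Π|.  Conversely, a cycle in the
-- predicate dependency graph unrolls into an infinite walk of rules of Π;
-- renaming the k-th rule by x ↦ k + x·(n+1) makes any n+1 consecutive ones
-- variable-disjoint, which gives a chain of every length n.
module Submission where

open import Defs
open import Data.Nat using (ℕ)
open import Data.Product using (∃-syntax)
open import Relation.Nullary using (¬_)
open import Function.Bundles using (_⇔_)

open import Data.Nat as ℕ using (zero; suc; _+_; _*_; _%_; _<_; NonZero)
open import Data.Nat.Properties using (+-cancelˡ-≡; *-cancelʳ-≡; n<1+n)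
open import Data.Nat.DivMod using ([m+kn]%n≡m%n; m<n⇒m%n≡m)
open import Data.List as List using ([]; _∷_; _++_; length)
open import Data.List.Properties using (map-++)
open import Data.List.Membership.Propositional using (_∈_)
open import Data.List.Membership.Propositional.Properties using (∈-map⁻)
open import Data.List.Relation.Unary.Any using (index)
open import Data.List.Relation.Unary.Any.Properties using (lookup-index)
open import Data.Vec using (tabulate)
open import Data.Vec.Properties using (lookup∘tabulate)
open import Data.Fin as Fin using (Fin; toℕ; inject₁)
open import Data.Fin.Properties using (pigeonhole; toℕ-injective; toℕ-inject₁; toℕ<n)
open import Data.Product using (Σ; _,_; proj₁; proj₂; map₂)
open import Relation.Binary.PropositionalEquality
open import Relation.Binary.Construct.Closure.Transitive using (TransClosure; [_]; _∷_)
open import Function.Bundles using (mk⇔)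
open import Function.Base using (_∘′_)
open import Function.Definitions using (Injective)

headPred : Rule → Pred
headPred r = Atom.pred (head r)

renF-≢⊥̇ : ∀ ρ {G} → G ≢ ⊥̇ → renF ρ G ≢ ⊥̇
renF-≢⊥̇ ρ {⊥̇} G≢⊥̇ _ = G≢⊥̇ refl
renF-≢⊥̇ ρ {atom _ _} _ ()
renF-≢⊥̇ ρ {_ ≐ _} _ ()
renF-≢⊥̇ ρ {_ ∧̇ _} _ ()
renF-≢⊥̇ ρ {_ ∨̇ _} _ ()
renF-≢⊥̇ ρ {_ ⇒̇ _} _ ()
renF-≢⊥̇ ρ {∀̇ _ _} _ ()
renF-≢⊥̇ ρ {∃̇ _ _} _ ()

NNOcc-renF : ∀ ρ {s q ts} F → NNOcc s (mkAtom q ts) F →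
             NNOcc s (mkAtom q (renTs ρ ts)) (renF ρ F)
NNOcc-renF ρ (atom _ _) here        = here
NNOcc-renF ρ (F ∧̇ _)   (∧l o)       = ∧l (NNOcc-renF ρ F o)
NNOcc-renF ρ (_ ∧̇ G)   (∧r o)       = ∧r (NNOcc-renF ρ G o)
NNOcc-renF ρ (F ∨̇ _)   (∨l o)       = ∨l (NNOcc-renF ρ F o)
NNOcc-renF ρ (_ ∨̇ G)   (∨r o)       = ∨r (NNOcc-renF ρ G o)
NNOcc-renF ρ (F ⇒̇ _)   (⇒ant ne o)  = ⇒ant (renF-≢⊥̇ ρ ne) (NNOcc-renF ρ F o)
NNOcc-renF ρ (_ ⇒̇ G)   (⇒con o)     = ⇒con (NNOcc-renF ρ G o)
NNOcc-renF ρ (∀̇ _ F)   (∀in o)      = ∀in (NNOcc-renF ρ F o)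
NNOcc-renF ρ (∃̇ _ F)   (∃in o)      = ∃in (NNOcc-renF ρ F o)

NNOcc-renF⁻ : ∀ ρ {s q ts} F → NNOcc s (mkAtom q ts) (renF ρ F) →
              ∃[ ts′ ] NNOcc s (mkAtom q ts′) F
NNOcc-renF⁻ ρ (atom _ ts) here       = ts , here
NNOcc-renF⁻ ρ (F ∧̇ _)    (∧l o)      = map₂ ∧l (NNOcc-renF⁻ ρ F o)
NNOcc-renF⁻ ρ (_ ∧̇ G)    (∧r o)      = map₂ ∧r (NNOcc-renF⁻ ρ G o)
NNOcc-renF⁻ ρ (F ∨̇ _)    (∨l o)      = map₂ ∨l (NNOcc-renF⁻ ρ F o)
NNOcc-renF⁻ ρ (_ ∨̇ G)    (∨r o)      = map₂ ∨r (NNOcc-renF⁻ ρ G o)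
NNOcc-renF⁻ ρ (F ⇒̇ _)    (⇒ant ne o) =
  map₂ (⇒ant (ne ∘′ cong (renF ρ))) (NNOcc-renF⁻ ρ F o)
NNOcc-renF⁻ ρ (_ ⇒̇ G)    (⇒con o)    = map₂ ⇒con (NNOcc-renF⁻ ρ G o)
NNOcc-renF⁻ ρ (∀̇ _ F)    (∀in o)     = map₂ ∀in (NNOcc-renF⁻ ρ F o)
NNOcc-renF⁻ ρ (∃̇ _ F)    (∃in o)     = map₂ ∃in (NNOcc-renF⁻ ρ F o)

RuleEdge-renR : ∀ ρ ρ′ {r r′} → RuleEdge r r′ → RuleEdge (renR ρ r) (renR ρ′ r′)
RuleEdge-renR ρ ρ′ {r} (s , o) = renTs ρ s , NNOcc-renF ρ (body r) o

RuleEdge-renR⁻ : ∀ ρ ρ′ {r r′} → RuleEdge (renR ρ r) (renR ρ′ r′) → RuleEdge r r′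
RuleEdge-renR⁻ ρ ρ′ {r} (_ , o) = NNOcc-renF⁻ ρ (body r) o

RuleEdge⇒PredEdge : ∀ {Π r r′} → r ∈ Π → RuleEdge r r′ → PredEdge Π (headPred r) (headPred r′)
RuleEdge⇒PredEdge {r = r} r∈Π (s , o) = r , r∈Π , refl , s , o

PredEdge⇒RuleEdge : ∀ {Π p q q′} (e : PredEdge Π p q) (e′ : PredEdge Π q q′) →
                    RuleEdge (proj₁ e) (proj₁ e′)
PredEdge⇒RuleEdge (_ , _ , _ , ts , o) (_ , _ , refl , _) = ts , o

++-≡-map : ∀ (f : Var → Var) {xs ys xs′ ys′} → xs′ ≡ List.map f xs → ys′ ≡ List.map f ys →
           xs′ ++ ys′ ≡ List.map f (xs ++ ys)
++-≡-map f {xs} {ys} refl refl = sym (map-++ f xs ys)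

mutual
  varsT-renT : ∀ ρ t → varsT (renT ρ t) ≡ List.map ρ (varsT t)
  varsT-renT ρ (var x)    = refl
  varsT-renT ρ (fun _ ts) = varsTs-renTs ρ ts

  varsTs-renTs : ∀ ρ ts → varsTs (renTs ρ ts) ≡ List.map ρ (varsTs ts)
  varsTs-renTs ρ []       = refl
  varsTs-renTs ρ (t ∷ ts) = ++-≡-map ρ (varsT-renT ρ t) (varsTs-renTs ρ ts)

varsF-renF : ∀ ρ F → varsF (renF ρ F) ≡ List.map ρ (varsF F)
varsF-renF ρ (atom _ ts) = varsTs-renTs ρ ts
varsF-renF ρ (s ≐ t)     = ++-≡-map ρ (varsT-renT ρ s) (varsT-renT ρ t)
varsF-renF ρ ⊥̇           = refl
varsF-renF ρ (F ∧̇ G)     = ++-≡-map ρ (varsF-renF ρ F) (varsF-renF ρ G)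
varsF-renF ρ (F ∨̇ G)     = ++-≡-map ρ (varsF-renF ρ F) (varsF-renF ρ G)
varsF-renF ρ (F ⇒̇ G)     = ++-≡-map ρ (varsF-renF ρ F) (varsF-renF ρ G)
varsF-renF ρ (∀̇ x F)     = cong (ρ x ∷_) (varsF-renF ρ F)
varsF-renF ρ (∃̇ x F)     = cong (ρ x ∷_) (varsF-renF ρ F)

varsR-renR : ∀ ρ r → varsR (renR ρ r) ≡ List.map ρ (varsR r)
varsR-renR ρ r = ++-≡-map ρ (varsTs-renTs ρ (Atom.args (head r))) (varsF-renF ρ (body r))

∈-varsR-renR : ∀ ρ r {x} → x ∈ varsR (renR ρ r) → ∃[ y ] x ≡ ρ y
∈-varsR-renR ρ r x∈ = map₂ proj₂ (∈-map⁻ ρ (subst (_ ∈_) (varsR-renR ρ r) x∈))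

index-injective : ∀ {A : Set} {x y : A} {xs} (x∈ : x ∈ xs) (y∈ : y ∈ xs) →
                  index x∈ ≡ index y∈ → x ≡ y
index-injective {xs = xs} x∈ y∈ eq =
  trans (lookup-index x∈) (trans (cong (List.lookup xs) eq) (sym (lookup-index y∈)))

module _ {A : Set} {R : A → A → Set} where

  walk⇒TransClosure : ∀ {n} (P : Fin (suc n) → A) → (∀ i → R (P (inject₁ i)) (P (Fin.suc i))) →
                      ∀ {i j} → i Fin.< j → TransClosure R (P i) (P j)
  walk⇒TransClosure {suc n} P step {Fin.zero} {Fin.suc Fin.zero} _ = [ step Fin.zero ]
  walk⇒TransClosure {suc n} P step {Fin.zero} {Fin.suc (Fin.suc j)} _ =
    step Fin.zero ∷ walk⇒TransClosure (P ∘′ Fin.suc) (λ i → step (Fin.suc i))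
                                      {Fin.zero} {Fin.suc j} (ℕ.s≤s ℕ.z≤n)
  walk⇒TransClosure {suc n} P step {Fin.suc i} {Fin.suc j} (ℕ.s≤s i<j) =
    walk⇒TransClosure (P ∘′ Fin.suc) (λ i → step (Fin.suc i)) i<j

  module Unroll {p} (cycle : TransClosure R p p) where

    walkFrom : ∀ {x} → TransClosure R x p → ℕ → A
    walkFrom {x} _       zero    = x
    walkFrom     [ _ ]   (suc k) = walkFrom cycle k
    walkFrom     (_ ∷ t) (suc k) = walkFrom t k

    walkFrom-step : ∀ {x} (t : TransClosure R x p) k → R (walkFrom t k) (walkFrom t (suc k))
    walkFrom-step [ e ]   zero    = e
    walkFrom-step (e ∷ _) zero    = e
    walkFrom-step [ _ ]   (suc k) = walkFrom-step cycle k
    walkFrom-step (_ ∷ t) (suc k) = walkFrom-step t k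

  cycle⇒infiniteWalk : ∀ {p} → TransClosure R p p → Σ (ℕ → A) λ f → ∀ k → R (f k) (f (suc k))
  cycle⇒infiniteWalk cycle = walkFrom cycle , walkFrom-step cycle
    where open Unroll cycle

module _ {Π n} (chain : Chain Π n) where
  open Chain chain

  original : Fin (suc n) → Rule
  original i = proj₁ (vertices i)

  original-∈ : ∀ i → original i ∈ Π
  original-∈ i = proj₁ (proj₂ (vertices i))

  original-edge : ∀ i → RuleEdge (original (inject₁ i)) (original (Fin.suc i))
  original-edge i with vertices (inject₁ i) | vertices (Fin.suc i) | edges i
  ... | r , _ , ρ , _ , eq | r′ , _ , ρ′ , _ , eq′ | edge =
    RuleEdge-renR⁻ ρ ρ′ {r} {r′} (subst₂ RuleEdge eq eq′ edge)

Tight⇒¬Chain : ∀ {Π} → Tight Π → ¬ Chain Π (length Π)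
Tight⇒¬Chain {Π} tight chain
  with pigeonhole (n<1+n (length Π)) (λ i → index (original-∈ chain i))
... | i , j , i<j , same-index =
  tight (P j) (subst (λ p → TransClosure (PredEdge Π) p (P j)) P-i≡P-j
                     (walk⇒TransClosure P step i<j))
  where
  P : Fin (suc (length Π)) → Pred
  P i = headPred (original chain i)

  step : ∀ i → PredEdge Π (P (inject₁ i)) (P (Fin.suc i))
  step i = RuleEdge⇒PredEdge {r′ = original chain (Fin.suc i)}
                             (original-∈ chain (inject₁ i)) (original-edge chain i)

  P-i≡P-j : P i ≡ P j
  P-i≡P-j = cong headPred (index-injective (original-∈ chain i) (original-∈ chain j) same-index)

tag : ℕ → ℕ → Var → Var
tag N k x = k + x * N

tag-injective : ∀ N k .{{_ : NonZero N}} → Injective _≡_ _≡_ (tag N k)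
tag-injective N k {x} {y} eq = *-cancelʳ-≡ x y N (+-cancelˡ-≡ k (x * N) (y * N) eq)

tag-% : ∀ N k x .{{_ : NonZero N}} → k < N → tag N k x % N ≡ k
tag-% N k x k<N = trans ([m+kn]%n≡m%n k x N) (m<n⇒m%n≡m k<N)

ruleWalk⇒Chain : ∀ {Π} (r : ℕ → Rule) → (∀ k → r k ∈ Π) → (∀ k → RuleEdge (r k) (r (suc k))) →
                 ∀ n → Chain Π n
ruleWalk⇒Chain {Π} r r-∈ r-edge n = record
  { rules    = tabulate renamed
  ; vertices = λ i → subst (IsVertex Π) (sym (lookup∘tabulate renamed i)) (vertex i)
  ; edges    = λ i → subst₂ RuleEdge (sym (lookup∘tabulate renamed (inject₁ i)))
                                     (sym (lookup∘tabulate renamed (Fin.suc i))) (edge i)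
  ; disjoint = λ i j i≢j x x∈i x∈j →
      i≢j (disjoint i j x (subst (x ∈_) (cong varsR (lookup∘tabulate renamed i)) x∈i)
                          (subst (x ∈_) (cong varsR (lookup∘tabulate renamed j)) x∈j))
  }
  where
  N = suc n

  renamed : Fin N → Rule
  renamed i = renR (tag N (toℕ i)) (r (toℕ i))

  vertex : ∀ i → IsVertex Π (renamed i)
  vertex i = r (toℕ i) , r-∈ (toℕ i) , tag N (toℕ i) , tag-injective N (toℕ i) , refl

  edge : ∀ i → RuleEdge (renamed (inject₁ i)) (renamed (Fin.suc i))
  edge i rewrite toℕ-inject₁ i =
    RuleEdge-renR (tag N (toℕ i)) (tag N (suc (toℕ i))) {r (toℕ i)} {r (suc (toℕ i))} (r-edge (toℕ i))

  -- A variable of a renamed rule determines its position: it is the residue mod N.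
  disjoint : ∀ i j x → x ∈ varsR (renamed i) → x ∈ varsR (renamed j) → i ≡ j
  disjoint i j x x∈i x∈j with ∈-varsR-renR _ (r (toℕ i)) x∈i | ∈-varsR-renR _ (r (toℕ j)) x∈j
  ... | y , refl | y′ , x≡ =
    toℕ-injective (begin
      toℕ i                    ≡⟨ tag-% N (toℕ i) y (toℕ<n i) ⟨
      tag N (toℕ i) y % N      ≡⟨ cong (_% N) x≡ ⟩
      tag N (toℕ j) y′ % N     ≡⟨ tag-% N (toℕ j) y′ (toℕ<n j) ⟩
      toℕ j                    ∎)
    where open ≡-Reasoning

cycle⇒Chain : ∀ {Π p} → TransClosure (PredEdge Π) p p → ∀ n → Chain Π n
cycle⇒Chain cycle with cycle⇒infiniteWalk cycle
... | _ , step = ruleWalk⇒Chain (λ k → proj₁ (step k)) (λ k → proj₁ (proj₂ (step k)))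
                                (λ k → PredEdge⇒RuleEdge (step k) (step (suc k)))

corollary1 : (Π : Program) → Tight Π ⇔ (∃[ n ] ¬ Chain Π n)
corollary1 Π = mk⇔ (λ tight → length Π , Tight⇒¬Chain tight)
                   (λ (n , no-chain) p cycle → no-chain (cycle⇒Chain cycle n))
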